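{- Let $q$ be a prime power, $t$ a positive integer, $n=2t$, $\xi,\eta\in\mathbb{F}_{q^n}\setminus\mathbb{F}_{q^t}$ and $f,g\in\mathcal{L}_{t,q}$. Let $A,B,a,b\in\mathbb{F}_{q^t}$ be such that $\xi^2=A\xi+B$ and $\eta=a\xi+b$. Let $\alpha\in\mathbb{F}_{q^n}^*$ and write $\alpha^{ -1}=\alpha_0+\xi\alpha_1$ with $\alpha_0,\alpha_1\in\mathbb{F}_{q^t}$. Then the weight of the point $\langle(1,\alpha)\rangle_{\mathbb{F}_{q^n}}$ in the linear set $L_{S_{f,\xi}\times S_{g,\eta}}$ equals $$\dim_{\mathbb{F}_q}\ker\Big(f\big(\alpha_0X+(\alpha_0b+a\alpha_1B)g(X)\big)-\alpha_1X-(a\alpha_0+a\alpha_1A+b\alpha_1)g(X)\Big),$$ where the kernel is that of the given $\mathbb{F}_q$-linear map $\mathbb{F}_{q^t}\to\mathbb{F}_{q^t}$.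
   Context: $\mathcal{L}_{t,q}$ is the set of $\mathbb{F}_q$-linearised polynomials $\sum_{i=0}^{t-1}c_iX^{q^i}$ with $c_i\in\mathbb{F}_{q^t}$, regarded as $\mathbb{F}_q$-linear maps of $\mathbb{F}_{q^t}$. For $h\in\mathcal{L}_{t,q}$ and $\zeta\in\mathbb{F}_{q^{2t}}\setminus\mathbb{F}_{q^t}$, $S_{h,\zeta}=\{u+\zeta h(u): u\in\mathbb{F}_{q^t}\}\subseteq\mathbb{F}_{q^{2t}}$. For an $\mathbb{F}_q$-subspace $U$ of $\mathbb{F}_{q^n}^2$, $L_U=\{\langle u\rangle_{\mathbb{F}_{q^n}}: u\in U\setminus\{0\}\}\subseteq\mathrm{PG}(1,q^n)$, and the weight of a point $\langle v\rangle_{\mathbb{F}_{q^n}}$ is $\dim_{\mathbb{F}_q}(U\cap\langle v\rangle_{\mathbb{F}_{q^n}})$ (0 if the point is not in $L_U$). $S\times T=\{(s,t):s\in S,t\in T\}$. -}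

module Defs where

open import Level using (Level; _⊔_)
open import Data.Nat as ℕ using (ℕ; zero; suc)
open import Data.Nat.Primality using (Prime)
open import Data.Fin using (Fin; zero; suc; toℕ)
open import Data.Product using (Σ; ∃; _×_; _,_)
open import Relation.Nullary using (¬_)
open import Relation.Binary.PropositionalEquality using (_≡_)
open import Algebra.Bundles using (CommutativeRing)

IsPrimePower : ℕ → Set
IsPrimePower q = Σ ℕ λ p → Σ ℕ λ k → Prime p × (1 ℕ.≤ k) × (q ≡ p ℕ.^ k)

sumFin : ∀ {a} {A : Set a} → (A → A → A) → A → (k : ℕ) → (Fin k → A) → A
sumFin _⊕_ e zero    v = e
sumFin _⊕_ e (suc k) v = v zero ⊕ sumFin _⊕_ e k (λ i → v (suc i))

module _ {c ℓ : Level} (R : CommutativeRing c ℓ) where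
  open CommutativeRing R

  IsField : Set (c ⊔ ℓ)
  IsField = (¬ (1# ≈ 0#)) × (∀ x → ¬ (x ≈ 0#) → ∃ λ y → x * y ≈ 1#)

  HasSize : ℕ → Set (c ⊔ ℓ)
  HasSize N = Σ (Fin N → Carrier) λ e →
                (∀ i j → e i ≈ e j → i ≡ j) × (∀ x → ∃ λ i → e i ≈ x)

  pow : Carrier → ℕ → Carrier
  pow x zero    = 1#
  pow x (suc n) = x * pow x n

  -- membership in the subfield F_{q^m} = { x | x^(q^m) = x }
  InSub : ℕ → ℕ → Carrier → Set ℓ
  InSub q m x = pow x (q ℕ.^ m) ≈ x

  -- a q-linearised polynomial with t coefficients, as a coefficient vector
  -- c : Fin t → K (the hypothesis c i ∈ F_{q^t} is imposed separately)
  IsLinPoly : ℕ → (t : ℕ) → (Fin t → Carrier) → Set ℓ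
  IsLinPoly q t c = ∀ i → InSub q t (c i)

  evalLin : ℕ → (t : ℕ) → (Fin t → Carrier) → Carrier → Carrier
  evalLin q t c u = sumFin _+_ 0# t (λ i → c i * pow u (q ℕ.^ toℕ i))

  InS : ℕ → (t : ℕ) → (Fin t → Carrier) → Carrier → Carrier → Set (c ⊔ ℓ)
  InS q t h ζ x = ∃ λ u → InSub q t u × (x ≈ u + ζ * evalLin q t h u)

  -- F_q-dimension of an F_q-subspace W of an R-module V (scalars restricted
  -- to F_q = { x | x^q = x }): W has an F_q-basis of size k.
  module _ {v r : Level} (V : Set v) (_≈V_ : V → V → Set r) (_⊕_ : V → V → V)
           (0V : V) (_·_ : Carrier → V → V) (q : ℕ) where
    HasDim : ∀ {w} → (V → Set w) → ℕ → Set (c ⊔ ℓ ⊔ v ⊔ r ⊔ w)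
    HasDim W k = Σ (Fin k → V) λ b →
        (∀ i → W (b i))
      × (∀ (λs : Fin k → Carrier) → (∀ i → InSub q 1 (λs i)) →
           sumFin _⊕_ 0V k (λ i → λs i · b i) ≈V 0V → ∀ i → λs i ≈ 0#)
      × (∀ x → W x → ∃ λ (λs : Fin k → Carrier) → (∀ i → InSub q 1 (λs i)) ×
           (x ≈V sumFin _⊕_ 0V k (λ i → λs i · b i)))

  HasDim₁ : ∀ {w} → ℕ → (Carrier → Set w) → ℕ → Set (c ⊔ ℓ ⊔ w)
  HasDim₁ q W k = HasDim Carrier _≈_ _+_ 0# _*_ q W k

  HasDim₂ : ∀ {w} → ℕ → (Carrier × Carrier → Set w) → ℕ → Set (c ⊔ ℓ ⊔ w)
  HasDim₂ q W k =
    HasDim (Carrier × Carrier)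
      (λ { (x , y) (x' , y') → (x ≈ x') × (y ≈ y') })
      (λ { (x , y) (x' , y') → (x + x' , y + y') })
      (0# , 0#)
      (λ { s (x , y) → (s * x , s * y) })
      q W k

  -- U ∩ ⟨(1,α)⟩_{F_{q^n}} for U = S_{f,ξ} × S_{g,η}
  InWeightSpace : ℕ → (t : ℕ) → (Fin t → Carrier) → Carrier → (Fin t → Carrier) → Carrier →
                  Carrier → Carrier × Carrier → Set (c ⊔ ℓ)
  InWeightSpace q t f ξ g η α (x , y) =
    (InS q t f ξ x × InS q t g η y) × (∃ λ λ' → (x ≈ λ' * 1#) × (y ≈ λ' * α))

{-# OPTIONS --safe #-}
-- Write ω = α₀ + ξα₁ = α⁻¹ and Y(v) = v + η g(v) for v ∈ 𝔽_{q^t}. The points of S_{f,ξ} × S_{g,η} on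
-- ⟨(1, α)⟩ are the pairs (ω Y(v), Y(v)) with ω Y(v) ∈ S_{f,ξ}. Substituting η = aξ + b and ξ² = Aξ + B
-- gives ω Y(v) = U(v) + ξ V(v) with U(v), V(v) ∈ 𝔽_{q^t} (V(v) = α₁v + (aα₀ + aα₁A + bα₁) g(v)), and as
-- 1, ξ are linearly independent over 𝔽_{q^t}, this lies in S_{f,ξ} iff f(U(v)) = V(v). So v ↦ (ω Y(v), Y(v))
-- is an 𝔽_q-linear bijection from the kernel onto the weight space, hence preserves dimension.
-- 𝔽_q-linearity of f and g needs x ↦ x^q to be additive. Translation by 1 permutes the field, so
-- q^{2t}·1 = 0; as q is a power of the prime p and a field has no zero divisors, p·1 = 0, and the
-- binomial theorem applies since p divides p C k for 0 < k < p.
module Submission where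

open import Level using (Level; _⊔_)
open import Data.Nat using (ℕ)
open import Data.Fin using (Fin)
open import Relation.Nullary using (¬_)
open import Algebra.Bundles using (CommutativeRing)
open import Defs

module BinomialDivisibility where
  open import Data.Nat.Base
  open import Data.Nat.Properties
  open import Data.Nat.Divisibility
  open import Data.Nat.DivMod using (m*n/n≡m)
  open import Data.Nat.Primality using (Prime; euclidsLemma; ¬prime[1])
  open import Data.Nat.Combinatorics using (_C_; nCk≡n!/k![n-k]!; k![n∸k]!∣n!)
  open import Data.Sum using (inj₁; inj₂)
  open import Data.Empty using (⊥-elim)
  open import Relation.Binary.PropositionalEquality

  prime∤factorial : ∀ {p m} → Prime p → m < p → ¬ p ∣ m !
  prime∤factorial {m = zero} pp _ p∣1 = ¬prime[1] (subst Prime (∣1⇒≡1 p∣1) pp)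
  prime∤factorial {m = suc m} pp m<p p∣m! with euclidsLemma (suc m) (m !) pp p∣m!
  ... | inj₁ p∣1+m  = <⇒≱ m<p (∣⇒≤ p∣1+m)
  ... | inj₂ p∣m!′ = prime∤factorial pp (<-trans (n<1+n m) m<p) p∣m!′

  prime∣factorial : ∀ {p} → Prime p → p ∣ p !
  prime∣factorial {suc p} _ = m∣m*n (p !)

  prime∣binomial : ∀ {p k} → Prime p → 0 < k → k < p → p ∣ p C k
  prime∣binomial {p} {k} pp 0<k k<p with k![n∸k]!∣n! (<⇒≤ k<p)
  ... | divides c p!≡c*d = subst (p ∣_) (sym pCk≡c) p∣c
    where
    d : ℕ
    d = k ! * (p ∸ k) !
    instance
      d≢0 : NonZero d
      d≢0 = k !* (p ∸ k) !≢0
    pCk≡c : p C k ≡ c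
    pCk≡c = trans (nCk≡n!/k![n-k]! (<⇒≤ k<p)) (trans (cong (_/ d) p!≡c*d) (m*n/n≡m c d))
    p∣c : p ∣ c
    p∣c with euclidsLemma c d pp (subst (p ∣_) p!≡c*d (prime∣factorial pp))
    ... | inj₁ p∣c = p∣c
    ... | inj₂ p∣d with euclidsLemma (k !) ((p ∸ k) !) pp p∣d
    ...   | inj₁ p∣k!     = ⊥-elim (prime∤factorial pp k<p p∣k!)
    ...   | inj₂ p∣[p∸k]! = ⊥-elim (prime∤factorial pp (∸-monoʳ-< 0<k (<⇒≤ k<p)) p∣[p∸k]!)

module Frobenius {c ℓ : Level} (R : CommutativeRing c ℓ) where
  open import Data.Nat.Base as ℕ using (zero; suc; z<s; s<s)
  open import Data.Nat.Properties as ℕ using (≤-reflexive; ≤-trans)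
  open import Data.Nat.Divisibility using (_∣_; divides)
  open import Data.Nat.Primality using (Prime; ¬prime[0])
  open import Data.Empty using (⊥-elim)
  open import Data.Nat.Combinatorics using (_C_; nCn≡1)
  open import Data.Fin.Base using (zero; suc; fromℕ; inject₁)
  open import Data.Fin.Properties using (toℕ-inject₁; toℕ-fromℕ; toℕ<n)
  import Relation.Binary.PropositionalEquality as ≡
  open CommutativeRing R hiding (zero)
  open import Algebra.Properties.Semiring.Exp semiring using (_^_; ^-congˡ; ^-assocʳ)
  open import Algebra.Properties.Semiring.Mult semiring using (_×_; ×-congʳ; ×-assoc-*; ×1-homo-*)
  open import Algebra.Properties.Semiring.Sum semiring using (sum; sum-cong-≋; sum-replicate-zero; sum-init-last)
  open import Algebra.Properties.CommutativeSemiring.Binomial commutativeSemiring using (theorem; binomialTerm)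
  open import Relation.Binary.Reasoning.Setoid setoid
  open BinomialDivisibility

  AdditivePower : ℕ → Set _
  AdditivePower e = ∀ x y → (x + y) ^ e ≈ x ^ e + y ^ e

  additivePower-* : ∀ {m n} → AdditivePower m → AdditivePower n → AdditivePower (m ℕ.* n)
  additivePower-* {m} {n} +ᵐ +ⁿ x y = begin
    (x + y) ^ (m ℕ.* n)         ≈⟨ ^-assocʳ (x + y) m n ⟨
    ((x + y) ^ m) ^ n           ≈⟨ ^-congˡ n (+ᵐ x y) ⟩
    (x ^ m + y ^ m) ^ n         ≈⟨ +ⁿ (x ^ m) (y ^ m) ⟩
    (x ^ m) ^ n + (y ^ m) ^ n   ≈⟨ +-cong (^-assocʳ x m n) (^-assocʳ y m n) ⟩
    x ^ (m ℕ.* n) + y ^ (m ℕ.* n) ∎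

  additivePower-^ : ∀ {m} → AdditivePower m → ∀ j → AdditivePower (m ℕ.^ j)
  additivePower-^ +ᵐ zero    x y = trans (*-identityʳ (x + y)) (sym (+-cong (*-identityʳ x) (*-identityʳ y)))
  additivePower-^ {m} +ᵐ (suc j) = additivePower-* {m} {m ℕ.^ j} +ᵐ (additivePower-^ +ᵐ j)

  multiple×≈0 : ∀ {p n} → p × 1# ≈ 0# → p ∣ n → ∀ x → n × x ≈ 0#
  multiple×≈0 {p} p·1≈0 (divides c ≡.refl) x = begin
    (c ℕ.* p) × x                ≈⟨ ×-congʳ (c ℕ.* p) (*-identityˡ x) ⟨
    (c ℕ.* p) × (1# * x)         ≈⟨ ×-assoc-* (c ℕ.* p) 1# x ⟨
    ((c ℕ.* p) × 1#) * x         ≈⟨ *-congʳ (×1-homo-* c p) ⟩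
    ((c × 1#) * (p × 1#)) * x    ≈⟨ *-congʳ (*-congˡ p·1≈0) ⟩
    ((c × 1#) * 0#) * x          ≈⟨ *-congʳ (zeroʳ (c × 1#)) ⟩
    0# * x                       ≈⟨ zeroˡ x ⟩
    0# ∎

  frobenius : ∀ {p} → Prime p → p × 1# ≈ 0# → AdditivePower p
  frobenius {zero} isPrime = ⊥-elim (¬prime[0] isPrime)
  frobenius {suc p′} isPrime p·1≈0 x y = begin
    (x + y) ^ p                                       ≈⟨ theorem p x y ⟩
    term zero + sum (λ i → term (suc i))              ≈⟨ +-congˡ (sum-init-last (λ i → term (suc i))) ⟩
    term zero + (sum interior + term (suc (fromℕ p′))) ≈⟨ +-cong first (+-cong interior≈0 last) ⟩
    y ^ p + (0# + x ^ p)                              ≈⟨ +-congˡ (+-identityˡ (x ^ p)) ⟩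
    y ^ p + x ^ p                                     ≈⟨ +-comm (y ^ p) (x ^ p) ⟩
    x ^ p + y ^ p                                     ∎
    where
    p : ℕ
    p = suc p′
    term : Fin (suc p) → Carrier
    term = binomialTerm x y p
    interior : Fin p′ → Carrier
    interior j = term (suc (inject₁ j))
    first : term zero ≈ y ^ p
    first = trans (+-identityʳ _) (*-identityˡ (y ^ p))
    interior≈0 : sum interior ≈ 0#
    interior≈0 = trans (sum-cong-≋ vanishes) (sum-replicate-zero p′)
      where
      vanishes : ∀ j → interior j ≈ 0#
      vanishes j = multiple×≈0 p·1≈0
        (prime∣binomial isPrime z<s (s<s (≤-trans (≤-reflexive (≡.cong suc (toℕ-inject₁ j))) (toℕ<n j)))) _
    last : term (suc (fromℕ p′)) ≈ x ^ p
    last rewrite toℕ-fromℕ p′ | nCn≡1 p | ℕ.n∸n≡0 p =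
      trans (+-identityʳ _) (*-identityʳ (x ^ p))

module FieldProperties {c ℓ : Level} (K : CommutativeRing c ℓ) (isField : IsField K) where
  open import Data.Product using (proj₂; _,_)
  open CommutativeRing K
  open import Algebra.Properties.Ring ring using (-‿distribˡ-*; x≈y⇒x∙y⁻¹≈ε; x∙y⁻¹≈ε⇒x≈y)
  open import Relation.Binary.Reasoning.Setoid setoid

  x*y≈0⇒y≈0 : ∀ {x y} → ¬ x ≈ 0# → x * y ≈ 0# → y ≈ 0#
  x*y≈0⇒y≈0 {x} {y} x≉0 xy≈0 with proj₂ isField x x≉0
  ... | x⁻¹ , xx⁻¹≈1 = begin
    y               ≈⟨ *-identityˡ y ⟨
    1# * y          ≈⟨ *-congʳ xx⁻¹≈1 ⟨
    (x * x⁻¹) * y   ≈⟨ *-congʳ (*-comm x x⁻¹) ⟩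
    (x⁻¹ * x) * y   ≈⟨ *-assoc x⁻¹ x y ⟩
    x⁻¹ * (x * y)   ≈⟨ *-congˡ xy≈0 ⟩
    x⁻¹ * 0#        ≈⟨ zeroʳ x⁻¹ ⟩
    0#              ∎

  x*z≈y*z⇒z≈0 : ∀ {x y z} → ¬ x ≈ y → x * z ≈ y * z → z ≈ 0#
  x*z≈y*z⇒z≈0 {x} {y} {z} x≉y xz≈yz =
    x*y≈0⇒y≈0 (λ x-y≈0 → x≉y (x∙y⁻¹≈ε⇒x≈y x y x-y≈0)) (begin
      (x - y) * z       ≈⟨ distribʳ z x (- y) ⟩
      x * z + - y * z   ≈⟨ +-congˡ (-‿distribˡ-* y z) ⟨
      x * z - y * z     ≈⟨ x≈y⇒x∙y⁻¹≈ε xz≈yz ⟩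
      0#                ∎)

module FiniteField {c ℓ : Level} (K : CommutativeRing c ℓ) (isField : IsField K)
                   {N} (size : HasSize K N) where
  open import Data.Nat.Base as ℕ using (zero; suc)
  import Data.Nat.Properties as ℕ
  open import Data.Empty using (⊥-elim)
  import Data.Fin as Fin
  open import Data.Fin.Permutation using (Permutation; permutation)
  open import Data.Product using (proj₁; proj₂; _,_)
  open import Relation.Nullary using (yes; no)
  open import Relation.Binary.Definitions using (Decidable)
  open import Relation.Binary.PropositionalEquality as ≡ using (_≡_)
  open CommutativeRing K
  open import Algebra.Properties.Semiring.Exp semiring using (_^_)
  open import Algebra.Properties.Semiring.Mult semiring using (_×_; ×1-homo-*)
  open import Algebra.Properties.Semiring.Sum semiring using (sum; sum-permute; sum-cong-≋; ∑-distrib-+; sum-replicate)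
  open import Algebra.Properties.AbelianGroup +-abelianGroup using (identityʳ-unique; //-rightDividesˡ; //-rightDividesʳ)
  open import Relation.Binary.Reasoning.Setoid setoid
  open Frobenius K using (AdditivePower; additivePower-^; frobenius)
  open FieldProperties K isField

  private
    enum : Fin N → Carrier
    enum = proj₁ size
    enum-injective : ∀ i j → enum i ≈ enum j → i ≡ j
    enum-injective = proj₁ (proj₂ size)
    index : Carrier → Fin N
    index x = proj₁ (proj₂ (proj₂ size) x)
    enum-index : ∀ x → enum (index x) ≈ x
    enum-index x = proj₂ (proj₂ (proj₂ size) x)

  _≟_ : Decidable _≈_
  x ≟ y with index x Fin.≟ index y
  ... | yes i≡j = yes (trans (sym (enum-index x)) (trans (reflexive (≡.cong enum i≡j)) (enum-index y)))
  ... | no i≢j  = no (λ x≈y → i≢j (enum-injective _ _ (trans (enum-index x) (trans x≈y (sym (enum-index y))))))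

  translation : Carrier → Permutation N N
  translation a = permutation (λ i → index (enum i + a)) (λ i → index (enum i - a))
    (λ i → enum-injective _ _ (trans (enum-index _) (trans (+-congʳ (enum-index _)) (//-rightDividesˡ a (enum i)))))
    (λ i → enum-injective _ _ (trans (enum-index _) (trans (+-congʳ (enum-index _)) (//-rightDividesʳ a (enum i)))))

  size×≈0 : ∀ a → N × a ≈ 0#
  size×≈0 a = identityʳ-unique (sum enum) (N × a) (sym (begin
    sum enum                            ≈⟨ sum-permute enum (translation a) ⟩
    sum (λ i → enum (index (enum i + a))) ≈⟨ sum-cong-≋ (λ i → enum-index (enum i + a)) ⟩
    sum (λ i → enum i + a)              ≈⟨ ∑-distrib-+ enum (λ _ → a) ⟩
    sum enum + sum {N} (λ _ → a)        ≈⟨ +-congˡ (sum-replicate N) ⟩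
    sum enum + N × a                    ∎))

  ^≈0⇒≈0 : ∀ {x} n → x ^ n ≈ 0# → x ≈ 0#
  ^≈0⇒≈0 zero    1≈0 = ⊥-elim (proj₁ isField 1≈0)
  ^≈0⇒≈0 {x} (suc n) xxⁿ≈0 with x ≟ 0#
  ... | yes x≈0 = x≈0
  ... | no  x≉0 = ^≈0⇒≈0 n (x*y≈0⇒y≈0 x≉0 xxⁿ≈0)

  ×1-homo-^ : ∀ p m → (p ℕ.^ m) × 1# ≈ (p × 1#) ^ m
  ×1-homo-^ p zero    = +-identityʳ 1#
  ×1-homo-^ p (suc m) = trans (×1-homo-* p (p ℕ.^ m)) (*-congˡ (×1-homo-^ p m))

  characteristic : ∀ {p m} → N ≡ p ℕ.^ m → p × 1# ≈ 0#
  characteristic {p} {m} ≡.refl = ^≈0⇒≈0 m (trans (sym (×1-homo-^ p m)) (size×≈0 1#))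

  primePower-additive : ∀ {q n} → IsPrimePower q → N ≡ q ℕ.^ n → AdditivePower q
  primePower-additive {n = n} (p , m , p-prime , _ , ≡.refl) N≡qⁿ =
    additivePower-^ (frobenius p-prime (characteristic {p} {m ℕ.* n} (≡.trans N≡qⁿ (ℕ.^-*-assoc p m n)))) m

module FqLinear {c ℓ : Level} (K : CommutativeRing c ℓ) (q : ℕ) where
  open import Data.Nat.Base using (zero; suc)
  open import Data.Fin.Base using (zero; suc)
  open import Data.Product using (Σ; _×_; _,_; proj₁; proj₂)
  open import Algebra.Module.Bundles using (LeftModule)
  import Algebra.Module.Construct.TensorUnit as TensorUnit
  import Algebra.Module.Construct.DirectProduct as DirectProduct
  open CommutativeRing K using (Carrier; ring)

  FqScalars : ∀ {k} → (Fin k → Carrier) → Set ℓ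
  FqScalars ls = ∀ i → InSub K q 1 (ls i)

  module _ {m ℓm} (M : LeftModule ring m ℓm) where
    open LeftModule M

    combination : ∀ {k} → (Fin k → Carrier) → (Fin k → Carrierᴹ) → Carrierᴹ
    combination {k} ls xs = sumFin _+ᴹ_ 0ᴹ k (λ i → ls i *ₗ xs i)

    combination-congʳ : ∀ {k} ls {xs ys : Fin k → Carrierᴹ} → (∀ i → xs i ≈ᴹ ys i) →
                        combination ls xs ≈ᴹ combination ls ys
    combination-congʳ {zero}  ls xs≈ys = ≈ᴹ-refl
    combination-congʳ {suc k} ls xs≈ys =
      +ᴹ-cong (*ₗ-congˡ (xs≈ys zero)) (combination-congʳ (λ i → ls (suc i)) (λ i → xs≈ys (suc i)))

    HasDimᴹ : ∀ {w} → (Carrierᴹ → Set w) → ℕ → Set _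
    HasDimᴹ = HasDim K Carrierᴹ _≈ᴹ_ _+ᴹ_ 0ᴹ _*ₗ_ q

  module _ {m₁ ℓm₁ m₂ ℓm₂} (M₁ : LeftModule ring m₁ ℓm₁) (M₂ : LeftModule ring m₂ ℓm₂) where
    private
      module M₁ = LeftModule M₁
      module M₂ = LeftModule M₂
    open M₂ using (_≈ᴹ_; _+ᴹ_; _*ₗ_; 0ᴹ)

    record IsFqLinear (φ : M₁.Carrierᴹ → M₂.Carrierᴹ) : Set (c ⊔ ℓ ⊔ m₁ ⊔ ℓm₁ ⊔ ℓm₂) where
      field
        cong    : ∀ {x y} → x M₁.≈ᴹ y → φ x ≈ᴹ φ y
        +-homo  : ∀ x y → φ (x M₁.+ᴹ y) ≈ᴹ φ x +ᴹ φ y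
        *ₗ-homo : ∀ l x → InSub K q 1 l → φ (l M₁.*ₗ x) ≈ᴹ l *ₗ φ x

      0-homo : φ M₁.0ᴹ ≈ᴹ 0ᴹ
      0-homo = identityˡ-unique (φ M₁.0ᴹ) (φ M₁.0ᴹ)
        (M₂.≈ᴹ-trans (M₂.≈ᴹ-sym (+-homo M₁.0ᴹ M₁.0ᴹ)) (cong (M₁.+ᴹ-identityˡ M₁.0ᴹ)))
        where open import Algebra.Properties.Group M₂.+ᴹ-group using (identityˡ-unique)

      combination-homo : ∀ {k} ls (xs : Fin k → M₁.Carrierᴹ) → FqScalars ls →
                         φ (combination M₁ ls xs) ≈ᴹ combination M₂ ls (λ i → φ (xs i))
      combination-homo {zero}  ls xs ls∈𝔽q = 0-homo
      combination-homo {suc k} ls xs ls∈𝔽q = M₂.≈ᴹ-trans (+-homo _ _) (M₂.+ᴹ-cong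
        (*ₗ-homo (ls zero) (xs zero) (ls∈𝔽q zero))
        (combination-homo (λ i → ls (suc i)) (λ i → xs (suc i)) (λ i → ls∈𝔽q (suc i))))

    module DimensionTransfer {φ : M₁.Carrierᴹ → M₂.Carrierᴹ} (linear : IsFqLinear φ)
      {d w₁ w₂} {D : M₁.Carrierᴹ → Set d} {W₁ : M₁.Carrierᴹ → Set w₁} {W₂ : M₂.Carrierᴹ → Set w₂}
      (D-combination : ∀ {k} ls (xs : Fin k → M₁.Carrierᴹ) →
                       FqScalars ls → (∀ i → D (xs i)) → D (combination M₁ ls xs))
      (W₁⊆D : ∀ {x} → W₁ x → D x)
      (injective : ∀ {x y} → D x → D y → φ x ≈ᴹ φ y → x M₁.≈ᴹ y)
      (maps : ∀ {x} → W₁ x → W₂ (φ x))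
      (onto : ∀ {y} → W₂ y → Σ M₁.Carrierᴹ λ x → W₁ x × y ≈ᴹ φ x)
      where
      open CommutativeRing K using (_≈_; 0#)
      open IsFqLinear linear
      open import Relation.Binary.Reasoning.Setoid M₂.≈ᴹ-setoid

      D-0ᴹ : D M₁.0ᴹ
      D-0ᴹ = D-combination {zero} (λ ()) (λ ()) (λ ()) (λ ())

      image-HasDim : ∀ {k} → HasDimᴹ M₁ W₁ k → HasDimᴹ M₂ W₂ k
      image-HasDim {k} (xs , xs∈W₁ , independent , spanning) =
        φxs , (λ i → maps (xs∈W₁ i)) , φxs-independent , φxs-spanning
        where
        φxs : Fin k → M₂.Carrierᴹ
        φxs i = φ (xs i)
        φxs-independent : ∀ ls → FqScalars ls → combination M₂ ls φxs ≈ᴹ 0ᴹ → ∀ i → ls i ≈ 0#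
        φxs-independent ls ls∈𝔽q ∑≈0 = independent ls ls∈𝔽q
          (injective (D-combination ls xs ls∈𝔽q (λ i → W₁⊆D (xs∈W₁ i))) D-0ᴹ (begin
            φ (combination M₁ ls xs)   ≈⟨ combination-homo ls xs ls∈𝔽q ⟩
            combination M₂ ls φxs      ≈⟨ ∑≈0 ⟩
            0ᴹ                         ≈⟨ 0-homo ⟨
            φ M₁.0ᴹ                    ∎))
        φxs-spanning : ∀ y → W₂ y → Σ (Fin k → Carrier) λ ls → FqScalars ls × y ≈ᴹ combination M₂ ls φxs
        φxs-spanning y y∈W₂ =
          let (x , x∈W₁ , y≈φx) = onto y∈W₂
              (ls , ls∈𝔽q , x≈∑) = spanning x x∈W₁
          in ls , ls∈𝔽q , (begin
            y                          ≈⟨ y≈φx ⟩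
            φ x                        ≈⟨ cong x≈∑ ⟩
            φ (combination M₁ ls xs)   ≈⟨ combination-homo ls xs ls∈𝔽q ⟩
            combination M₂ ls φxs      ∎)

      preimage-HasDim : ∀ {k} → HasDimᴹ M₂ W₂ k → HasDimᴹ M₁ W₁ k
      preimage-HasDim {k} (ys , ys∈W₂ , independent , spanning) =
        xs , xs∈W₁ , xs-independent , xs-spanning
        where
        xs : Fin k → M₁.Carrierᴹ
        xs i = proj₁ (onto (ys∈W₂ i))
        xs∈W₁ : ∀ i → W₁ (xs i)
        xs∈W₁ i = proj₁ (proj₂ (onto (ys∈W₂ i)))
        ∑ys≈φ∑xs : ∀ ls → FqScalars ls → combination M₂ ls ys ≈ᴹ φ (combination M₁ ls xs)
        ∑ys≈φ∑xs ls ls∈𝔽q = begin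
          combination M₂ ls ys                 ≈⟨ combination-congʳ M₂ ls (λ i → proj₂ (proj₂ (onto (ys∈W₂ i)))) ⟩
          combination M₂ ls (λ i → φ (xs i))   ≈⟨ combination-homo ls xs ls∈𝔽q ⟨
          φ (combination M₁ ls xs)             ∎
        xs-independent : ∀ ls → FqScalars ls → combination M₁ ls xs M₁.≈ᴹ M₁.0ᴹ → ∀ i → ls i ≈ 0#
        xs-independent ls ls∈𝔽q ∑≈0 = independent ls ls∈𝔽q (begin
          combination M₂ ls ys       ≈⟨ ∑ys≈φ∑xs ls ls∈𝔽q ⟩
          φ (combination M₁ ls xs)   ≈⟨ cong ∑≈0 ⟩
          φ M₁.0ᴹ                    ≈⟨ 0-homo ⟩
          0ᴹ                         ∎)
        xs-spanning : ∀ x → W₁ x → Σ (Fin k → Carrier) λ ls → FqScalars ls × x M₁.≈ᴹ combination M₁ ls xs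
        xs-spanning x x∈W₁ =
          let (ls , ls∈𝔽q , φx≈∑) = spanning (φ x) (maps x∈W₁)
          in ls , ls∈𝔽q , injective (W₁⊆D x∈W₁) (D-combination ls xs ls∈𝔽q (λ i → W₁⊆D (xs∈W₁ i)))
                                     (M₂.≈ᴹ-trans φx≈∑ (∑ys≈φ∑xs ls ls∈𝔽q))

  Kᴹ : LeftModule ring c ℓ
  Kᴹ = TensorUnit.leftModule

  id-linear : IsFqLinear Kᴹ Kᴹ (λ x → x)
  id-linear = record { cong = λ x≈y → x≈y ; +-homo = λ _ _ → refl ; *ₗ-homo = λ _ _ _ → refl }
    where open CommutativeRing K using (refl)

  module _ {m ℓm} {M : LeftModule ring m ℓm} where
    open CommutativeRing K hiding (zero; Carrier; ring)
    open import Algebra.Properties.CommutativeSemigroup +-commutativeSemigroup using (interchange)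
    open import Algebra.Properties.CommutativeSemigroup *-commutativeSemigroup using (x∙yz≈y∙xz)
    private module M = LeftModule M

    zero-linear : IsFqLinear M Kᴹ (λ _ → 0#)
    zero-linear = record
      { cong = λ _ → refl ; +-homo = λ _ _ → sym (+-identityʳ 0#) ; *ₗ-homo = λ l _ _ → sym (zeroʳ l) }

    +-linear : ∀ {φ ψ} → IsFqLinear M Kᴹ φ → IsFqLinear M Kᴹ ψ → IsFqLinear M Kᴹ (λ x → φ x + ψ x)
    +-linear {φ} {ψ} φ-linear ψ-linear = record
      { cong    = λ x≈y → +-cong (φ.cong x≈y) (ψ.cong x≈y)
      ; +-homo  = λ x y → trans (+-cong (φ.+-homo x y) (ψ.+-homo x y)) (interchange (φ x) (φ y) (ψ x) (ψ y))
      ; *ₗ-homo = λ l x l∈𝔽q → trans (+-cong (φ.*ₗ-homo l x l∈𝔽q) (ψ.*ₗ-homo l x l∈𝔽q))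
                                      (sym (distribˡ l (φ x) (ψ x)))
      }
      where
      module φ = IsFqLinear φ-linear
      module ψ = IsFqLinear ψ-linear

    *-linear : ∀ a {φ} → IsFqLinear M Kᴹ φ → IsFqLinear M Kᴹ (λ x → a * φ x)
    *-linear a {φ} φ-linear = record
      { cong    = λ x≈y → *-congˡ (φ.cong x≈y)
      ; +-homo  = λ x y → trans (*-congˡ (φ.+-homo x y)) (distribˡ a (φ x) (φ y))
      ; *ₗ-homo = λ l x l∈𝔽q → trans (*-congˡ (φ.*ₗ-homo l x l∈𝔽q)) (x∙yz≈y∙xz a l (φ x))
      }
      where module φ = IsFqLinear φ-linear

    sum-linear : ∀ k {φ : Fin k → M.Carrierᴹ → Carrier} → (∀ i → IsFqLinear M Kᴹ (φ i)) →
                 IsFqLinear M Kᴹ (λ x → sumFin _+_ 0# k (λ i → φ i x))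
    sum-linear zero    φ-linear = zero-linear
    sum-linear (suc k) φ-linear = +-linear (φ-linear zero) (sum-linear k (λ i → φ-linear (suc i)))

  module _ {m₁ ℓm₁ m₂ ℓm₂ m₃ ℓm₃} {M₁ : LeftModule ring m₁ ℓm₁}
           {M₂ : LeftModule ring m₂ ℓm₂} {M₃ : LeftModule ring m₃ ℓm₃} where

    pair-linear : ∀ {φ ψ} → IsFqLinear M₁ M₂ φ → IsFqLinear M₁ M₃ ψ →
                  IsFqLinear M₁ (DirectProduct.leftModule M₂ M₃) (λ x → φ x , ψ x)
    pair-linear φ-linear ψ-linear = record
      { cong    = λ x≈y → φ.cong x≈y , ψ.cong x≈y
      ; +-homo  = λ x y → φ.+-homo x y , ψ.+-homo x y
      ; *ₗ-homo = λ l x l∈𝔽q → φ.*ₗ-homo l x l∈𝔽q , ψ.*ₗ-homo l x l∈𝔽q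
      }
      where
      module φ = IsFqLinear φ-linear
      module ψ = IsFqLinear ψ-linear

module FixedField {c ℓ : Level} (K : CommutativeRing c ℓ) (isField : IsField K)
                  (q : ℕ) (additive : Frobenius.AdditivePower K q) where
  open import Data.Nat.Base as ℕ using (zero; suc)
  import Data.Nat.Properties as ℕ
  open import Data.Fin.Base using (zero; suc; toℕ)
  open import Data.Product using (_×_; _,_; proj₁; proj₂)
  open import Relation.Binary.PropositionalEquality as ≡ using (_≡_)
  open CommutativeRing K hiding (zero)
  open import Algebra.Properties.Semiring.Exp semiring using (_^_; ^-congˡ; ^-assocʳ)
  open import Algebra.Properties.CommutativeSemiring.Exp commutativeSemiring using (^-distrib-*)
  open import Algebra.Properties.Ring ring
    using (x+x≈x⇒x≈0; +-inverseʳ-unique; x∙y⁻¹≈ε⇒x≈y; x≈y⇒x∙y⁻¹≈ε; x[y-z]≈xy-xz; -‿+-comm)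
  open import Algebra.Properties.CommutativeSemigroup +-commutativeSemigroup using (interchange)
  open import Relation.Binary.Reasoning.Setoid setoid
  open Frobenius K using (additivePower-^)
  open FieldProperties K isField using (x*z≈y*z⇒z≈0)
  open FqLinear K q

  pow≡^ : ∀ x n → pow K x n ≡ x ^ n
  pow≡^ x zero    = ≡.refl
  pow≡^ x (suc n) = ≡.cong (x *_) (pow≡^ x n)

  pow-cong : ∀ n {x y} → x ≈ y → pow K x n ≈ pow K y n
  pow-cong n {x} {y} x≈y rewrite pow≡^ x n | pow≡^ y n = ^-congˡ n x≈y

  pow-distrib-* : ∀ x y n → pow K (x * y) n ≈ pow K x n * pow K y n
  pow-distrib-* x y n rewrite pow≡^ (x * y) n | pow≡^ x n | pow≡^ y n = ^-distrib-* x y n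

  pow-pow : ∀ x m n → pow K (pow K x m) n ≈ pow K x (m ℕ.* n)
  pow-pow x m n rewrite pow≡^ (pow K x m) n | pow≡^ x m | pow≡^ x (m ℕ.* n) = ^-assocʳ x m n

  pow-+ : ∀ i x y → pow K (x + y) (q ℕ.^ i) ≈ pow K x (q ℕ.^ i) + pow K y (q ℕ.^ i)
  pow-+ i x y rewrite pow≡^ (x + y) (q ℕ.^ i) | pow≡^ x (q ℕ.^ i) | pow≡^ y (q ℕ.^ i) =
    additivePower-^ additive i x y

  pow-0# : ∀ i → pow K 0# (q ℕ.^ i) ≈ 0#
  pow-0# i = x+x≈x⇒x≈0 _ (trans (sym (pow-+ i 0# 0#)) (pow-cong (q ℕ.^ i) (+-identityʳ 0#)))

  pow-neg : ∀ i x → pow K (- x) (q ℕ.^ i) ≈ - pow K x (q ℕ.^ i)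
  pow-neg i x = +-inverseʳ-unique _ _
    (trans (sym (pow-+ i x (- x))) (trans (pow-cong (q ℕ.^ i) (-‿inverseʳ x)) (pow-0# i)))

  InSub₁⇒InSub : ∀ t {l} → InSub K q 1 l → InSub K q t l
  InSub₁⇒InSub zero    {l} l∈ = *-identityʳ l
  InSub₁⇒InSub (suc t) {l} l∈ = begin
    pow K l (q ℕ.* q ℕ.^ t)        ≈⟨ pow-pow l q (q ℕ.^ t) ⟨
    pow K (pow K l q) (q ℕ.^ t)    ≈⟨ pow-cong (q ℕ.^ t) lᵠ≈l ⟩
    pow K l (q ℕ.^ t)              ≈⟨ InSub₁⇒InSub t l∈ ⟩
    l                              ∎
    where
    lᵠ≈l : pow K l q ≈ l
    lᵠ≈l = trans (reflexive (≡.cong (pow K l) (≡.sym (ℕ.*-identityʳ q)))) l∈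

  frobenius-linear : ∀ i → IsFqLinear Kᴹ Kᴹ (λ x → pow K x (q ℕ.^ i))
  frobenius-linear i = record
    { cong    = pow-cong (q ℕ.^ i)
    ; +-homo  = pow-+ i
    ; *ₗ-homo = λ l x l∈ → trans (pow-distrib-* l x (q ℕ.^ i)) (*-congʳ (InSub₁⇒InSub i l∈))
    }

  evalLin-linear : ∀ {t} h → IsFqLinear Kᴹ Kᴹ (evalLin K q t h)
  evalLin-linear {t} h = sum-linear t (λ i → *-linear (h i) (frobenius-linear (toℕ i)))

  module Subfield (t : ℕ) where

    InSub-0# : InSub K q t 0#
    InSub-0# = pow-0# t

    InSub-+ : ∀ {x y} → InSub K q t x → InSub K q t y → InSub K q t (x + y)
    InSub-+ {x} {y} x∈ y∈ = trans (pow-+ t x y) (+-cong x∈ y∈)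

    InSub-* : ∀ {x y} → InSub K q t x → InSub K q t y → InSub K q t (x * y)
    InSub-* {x} {y} x∈ y∈ = trans (pow-distrib-* x y (q ℕ.^ t)) (*-cong x∈ y∈)

    InSub-neg : ∀ {x} → InSub K q t x → InSub K q t (- x)
    InSub-neg {x} x∈ = trans (pow-neg t x) (-‿cong x∈)

    InSub-sub : ∀ {x y} → InSub K q t x → InSub K q t y → InSub K q t (x - y)
    InSub-sub x∈ y∈ = InSub-+ x∈ (InSub-neg y∈)

    InSub-pow : ∀ i {x} → InSub K q t x → InSub K q t (pow K x (q ℕ.^ i))
    InSub-pow i {x} x∈ = begin
      pow K (pow K x (q ℕ.^ i)) (q ℕ.^ t)  ≈⟨ pow-pow x (q ℕ.^ i) (q ℕ.^ t) ⟩
      pow K x (q ℕ.^ i ℕ.* q ℕ.^ t)        ≡⟨ ≡.cong (pow K x) (ℕ.*-comm (q ℕ.^ i) (q ℕ.^ t)) ⟩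
      pow K x (q ℕ.^ t ℕ.* q ℕ.^ i)        ≈⟨ pow-pow x (q ℕ.^ t) (q ℕ.^ i) ⟨
      pow K (pow K x (q ℕ.^ t)) (q ℕ.^ i)  ≈⟨ pow-cong (q ℕ.^ i) x∈ ⟩
      pow K x (q ℕ.^ i)                    ∎

    sum-InSub : ∀ k (xs : Fin k → Carrier) → (∀ i → InSub K q t (xs i)) → InSub K q t (sumFin _+_ 0# k xs)
    sum-InSub zero    xs xs∈ = InSub-0#
    sum-InSub (suc k) xs xs∈ = InSub-+ (xs∈ zero) (sum-InSub k (λ i → xs (suc i)) (λ i → xs∈ (suc i)))

    combination-InSub : ∀ {k} ls (xs : Fin k → Carrier) → FqScalars ls →
                        (∀ i → InSub K q t (xs i)) → InSub K q t (combination Kᴹ ls xs)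
    combination-InSub {k} ls xs ls∈ xs∈ =
      sum-InSub k _ (λ i → InSub-* (InSub₁⇒InSub t (ls∈ i)) (xs∈ i))

    evalLin-InSub : ∀ {h u} → IsLinPoly K q t h → InSub K q t u → InSub K q t (evalLin K q t h u)
    evalLin-InSub h∈ u∈ = sum-InSub t _ (λ i → InSub-* (h∈ i) (InSub-pow (toℕ i) u∈))

    module _ {ζ} (ζ∉ : ¬ InSub K q t ζ) where

      ζ-independent : ∀ {u s} → InSub K q t u → InSub K q t s → u + ζ * s ≈ 0# → u ≈ 0# × s ≈ 0#
      ζ-independent {u} {s} u∈ s∈ u+ζs≈0 = u≈0 , s≈0
        where
        Q : ℕ
        Q = q ℕ.^ t
        ζs≈-u : ζ * s ≈ - u
        ζs≈-u = +-inverseʳ-unique u (ζ * s) u+ζs≈0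
        s≈0 : s ≈ 0#
        s≈0 = x*z≈y*z⇒z≈0 ζ∉ (begin
          pow K ζ Q * s            ≈⟨ *-congˡ s∈ ⟨
          pow K ζ Q * pow K s Q    ≈⟨ pow-distrib-* ζ s Q ⟨
          pow K (ζ * s) Q          ≈⟨ pow-cong Q ζs≈-u ⟩
          pow K (- u) Q            ≈⟨ InSub-neg u∈ ⟩
          - u                      ≈⟨ ζs≈-u ⟨
          ζ * s                    ∎)
        u≈0 : u ≈ 0#
        u≈0 = begin
          u             ≈⟨ +-identityʳ u ⟨
          u + 0#        ≈⟨ +-congˡ (trans (*-congˡ s≈0) (zeroʳ ζ)) ⟨
          u + ζ * s     ≈⟨ u+ζs≈0 ⟩
          0#            ∎

      coordinates-unique : ∀ {u s u′ s′} → InSub K q t u → InSub K q t s → InSub K q t u′ → InSub K q t s′ →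
                           u + ζ * s ≈ u′ + ζ * s′ → u ≈ u′ × s ≈ s′
      coordinates-unique {u} {s} {u′} {s′} u∈ s∈ u′∈ s′∈ eq =
        x∙y⁻¹≈ε⇒x≈y u u′ (proj₁ differences≈0) , x∙y⁻¹≈ε⇒x≈y s s′ (proj₂ differences≈0)
        where
        differences≈0 : u - u′ ≈ 0# × s - s′ ≈ 0#
        differences≈0 = ζ-independent (InSub-sub u∈ u′∈) (InSub-sub s∈ s′∈) (begin
          (u - u′) + ζ * (s - s′)             ≈⟨ +-congˡ (x[y-z]≈xy-xz ζ s s′) ⟩
          (u - u′) + (ζ * s - ζ * s′)         ≈⟨ interchange u (- u′) (ζ * s) (- (ζ * s′)) ⟩
          (u + ζ * s) + (- u′ + - (ζ * s′))   ≈⟨ +-congˡ (-‿+-comm u′ (ζ * s′)) ⟩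
          (u + ζ * s) - (u′ + ζ * s′)         ≈⟨ x≈y⇒x∙y⁻¹≈ε eq ⟩
          0#                                  ∎)

module WeightSpace {c ℓ : Level} (K : CommutativeRing c ℓ) (isField : IsField K)
                   (q t : ℕ) (additive : Frobenius.AdditivePower K q) where
  open CommutativeRing K
  open import Data.Product using (Σ; _×_; _,_; proj₁; proj₂)
  import Algebra.Module.Construct.DirectProduct as DirectProduct
  open import Algebra.Properties.Ring ring using (x∙y⁻¹≈ε⇒x≈y; x≈y⇒x∙y⁻¹≈ε; -‿+-comm)
  open import Algebra.Properties.CommutativeSemigroup *-commutativeSemigroup using (x∙yz≈y∙zx)
  open import Algebra.Solver.Ring.NaturalCoefficients.Default commutativeSemiring
    using (solve; _:=_; _:+_; _:*_)
  open import Relation.Binary.Reasoning.Setoid setoid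
  open FixedField K isField q additive
  open Subfield t
  open FqLinear K q

  module Embedding
    {ξ η : Carrier} (ξ∉ : ¬ InSub K q t ξ) (η∉ : ¬ InSub K q t η)
    {f g : Fin t → Carrier} (f∈ : IsLinPoly K q t f) (g∈ : IsLinPoly K q t g)
    {A B a b : Carrier} (A∈ : InSub K q t A) (B∈ : InSub K q t B) (a∈ : InSub K q t a) (b∈ : InSub K q t b)
    (ξ² : ξ * ξ ≈ A * ξ + B) (η≈aξ+b : η ≈ a * ξ + b)
    {α α₀ α₁ : Carrier} (α₀∈ : InSub K q t α₀) (α₁∈ : InSub K q t α₁) (α[α₀+ξα₁]≈1 : α * (α₀ + ξ * α₁) ≈ 1#)
    where
    G : Carrier → Carrier
    G = evalLin K q t g

    Y : Carrier → Carrier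
    Y v = v + η * G v

    ω : Carrier
    ω = α₀ + ξ * α₁

    U : Carrier → Carrier
    U v = α₀ * v + (α₀ * b + a * α₁ * B) * G v

    V : Carrier → Carrier
    V v = α₁ * v + (a * α₀ + a * α₁ * A + b * α₁) * G v

    Kernel : Carrier → Set ℓ
    Kernel v = InSub K q t v × (evalLin K q t f (U v) - α₁ * v - (a * α₀ + a * α₁ * A + b * α₁) * G v ≈ 0#)

    embed : Carrier → Carrier × Carrier
    embed v = ω * Y v , Y v

    ωY≈U+ξV : ∀ v → ω * Y v ≈ U v + ξ * V v
    ωY≈U+ξV v = begin
      ω * (v + η * G v)
        ≈⟨ *-congˡ (+-congˡ (*-congʳ η≈aξ+b)) ⟩
      (α₀ + ξ * α₁) * (v + (a * ξ + b) * G v)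
        ≈⟨ solve 7 (λ α₀ α₁ ξ v a b G →
             (α₀ :+ ξ :* α₁) :* (v :+ (a :* ξ :+ b) :* G) :=
             (α₀ :* v :+ α₀ :* b :* G :+ ξ :* (α₁ :* v :+ (a :* α₀ :+ b :* α₁) :* G)) :+ a :* α₁ :* G :* (ξ :* ξ))
             refl α₀ α₁ ξ v a b (G v) ⟩
      (α₀ * v + α₀ * b * G v + ξ * (α₁ * v + (a * α₀ + b * α₁) * G v)) + a * α₁ * G v * (ξ * ξ)
        ≈⟨ +-congˡ (*-congˡ ξ²) ⟩
      (α₀ * v + α₀ * b * G v + ξ * (α₁ * v + (a * α₀ + b * α₁) * G v)) + a * α₁ * G v * (A * ξ + B)
        ≈⟨ solve 9 (λ α₀ α₁ ξ v a b G A B →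
             (α₀ :* v :+ α₀ :* b :* G :+ ξ :* (α₁ :* v :+ (a :* α₀ :+ b :* α₁) :* G)) :+ a :* α₁ :* G :* (A :* ξ :+ B) :=
             (α₀ :* v :+ (α₀ :* b :+ a :* α₁ :* B) :* G) :+ ξ :* (α₁ :* v :+ (a :* α₀ :+ a :* α₁ :* A :+ b :* α₁) :* G))
             refl α₀ α₁ ξ v a b (G v) A B ⟩
      U v + ξ * V v
        ∎

    ω*zα≈z : ∀ z → ω * (z * α) ≈ z
    ω*zα≈z z = begin
      ω * (z * α)   ≈⟨ x∙yz≈y∙zx ω z α ⟩
      z * (α * ω)   ≈⟨ *-congˡ α[α₀+ξα₁]≈1 ⟩
      z * 1#        ≈⟨ *-identityʳ z ⟩
      z             ∎

    G-InSub : ∀ {v} → InSub K q t v → InSub K q t (G v)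
    G-InSub = evalLin-InSub g∈

    U-InSub : ∀ {v} → InSub K q t v → InSub K q t (U v)
    U-InSub v∈ = InSub-+ (InSub-* α₀∈ v∈)
      (InSub-* (InSub-+ (InSub-* α₀∈ b∈) (InSub-* (InSub-* a∈ α₁∈) B∈)) (G-InSub v∈))

    V-InSub : ∀ {v} → InSub K q t v → InSub K q t (V v)
    V-InSub v∈ = InSub-+ (InSub-* α₁∈ v∈)
      (InSub-* (InSub-+ (InSub-+ (InSub-* a∈ α₀∈) (InSub-* (InSub-* a∈ α₁∈) A∈)) (InSub-* b∈ α₁∈)) (G-InSub v∈))

    x-y-z≈x-[y+z] : ∀ x y z → x - y - z ≈ x - (y + z)
    x-y-z≈x-[y+z] x y z = trans (+-assoc x (- y) (- z)) (+-congˡ (-‿+-comm y z))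

    kernel⇒fU≈V : ∀ {v} → Kernel v → evalLin K q t f (U v) ≈ V v
    kernel⇒fU≈V {v} (_ , fU-α₁v-cG≈0) = x∙y⁻¹≈ε⇒x≈y _ _ (trans (sym (x-y-z≈x-[y+z] _ _ _)) fU-α₁v-cG≈0)

    fU≈V⇒kernel : ∀ {v} → InSub K q t v → evalLin K q t f (U v) ≈ V v → Kernel v
    fU≈V⇒kernel v∈ fU≈V = v∈ , trans (x-y-z≈x-[y+z] _ _ _) (x≈y⇒x∙y⁻¹≈ε fU≈V)

    embed-linear : IsFqLinear Kᴹ (DirectProduct.leftModule Kᴹ Kᴹ) embed
    embed-linear = pair-linear (*-linear ω Y-linear) Y-linear
      where
      Y-linear : IsFqLinear Kᴹ Kᴹ Y
      Y-linear = +-linear id-linear (*-linear η (evalLin-linear g))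

    embed-injective : ∀ {x y} → InSub K q t x → InSub K q t y → (ω * Y x ≈ ω * Y y) × (Y x ≈ Y y) → x ≈ y
    embed-injective x∈ y∈ (_ , Yx≈Yy) = proj₁ (coordinates-unique η∉ x∈ (G-InSub x∈) y∈ (G-InSub y∈) Yx≈Yy)

    embed-maps : ∀ {v} → Kernel v → InWeightSpace K q t f ξ g η α (embed v)
    embed-maps {v} v∈Ker@(v∈ , _) =
      ( (U v , U-InSub v∈ , trans (ωY≈U+ξV v) (+-congˡ (*-congˡ (sym (kernel⇒fU≈V v∈Ker)))))
      , (v , v∈ , refl) )
      , (ω * Y v , sym (*-identityʳ (ω * Y v)) , sym (trans (*-assoc ω (Y v) α) (ω*zα≈z (Y v))))

    embed-onto : ∀ {p} → InWeightSpace K q t f ξ g η α p →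
                 Σ Carrier λ v → Kernel v × (proj₁ p ≈ ω * Y v) × (proj₂ p ≈ Y v)
    embed-onto {x , y} (((u , u∈ , x≈u+ξfu) , (v , v∈ , y≈Yv)) , (l , x≈l1 , y≈lα)) =
      v , fU≈V⇒kernel v∈ fU≈V , x≈ωYv , y≈Yv
      where
      x≈ωYv : x ≈ ω * Y v
      x≈ωYv = begin
        x             ≈⟨ x≈l1 ⟩
        l * 1#        ≈⟨ *-identityʳ l ⟩
        l             ≈⟨ ω*zα≈z l ⟨
        ω * (l * α)   ≈⟨ *-congˡ (trans (sym y≈lα) y≈Yv) ⟩
        ω * Y v       ∎
      coordinates : u ≈ U v × evalLin K q t f u ≈ V v
      coordinates = coordinates-unique ξ∉ u∈ (evalLin-InSub f∈ u∈) (U-InSub v∈) (V-InSub v∈)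
        (trans (sym x≈u+ξfu) (trans x≈ωYv (ωY≈U+ξV v)))
      fU≈V : evalLin K q t f (U v) ≈ V v
      fU≈V = trans (IsFqLinear.cong (evalLin-linear f) (sym (proj₁ coordinates))) (proj₂ coordinates)

    open DimensionTransfer Kᴹ (DirectProduct.leftModule Kᴹ Kᴹ) embed-linear
      combination-InSub proj₁ embed-injective embed-maps embed-onto public

open import Data.Nat using (_^_; _*_; _≤_)
open import Data.Product using (_×_; _,_)
open import Relation.Binary.PropositionalEquality using (refl)

corollary3p7 :
  ∀ {c ℓ : Level} (q t : ℕ) → IsPrimePower q → 1 ≤ t →
  (K : CommutativeRing c ℓ) →
  let open CommutativeRing K renaming (_*_ to _·_) in
  IsField K → HasSize K (q ^ (2 * t)) →
  (ξ η : Carrier) → ¬ InSub K q t ξ → ¬ InSub K q t η →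
  (f g : Fin t → Carrier) → IsLinPoly K q t f → IsLinPoly K q t g →
  (A B a b : Carrier) →
  InSub K q t A → InSub K q t B → InSub K q t a → InSub K q t b →
  ξ · ξ ≈ A · ξ + B → η ≈ a · ξ + b →
  (α : Carrier) → ¬ (α ≈ 0#) →
  (α₀ α₁ : Carrier) → InSub K q t α₀ → InSub K q t α₁ →
  α · (α₀ + ξ · α₁) ≈ 1# →
  (k : ℕ) →
    (HasDim₂ K q (InWeightSpace K q t f ξ g η α) k →
       HasDim₁ K q (λ u → InSub K q t u ×
          (evalLin K q t f (α₀ · u + (α₀ · b + a · α₁ · B) · evalLin K q t g u)
            - α₁ · u - (a · α₀ + a · α₁ · A + b · α₁) · evalLin K q t g u ≈ 0#)) k)
    × (HasDim₁ K q (λ u → InSub K q t u ×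
          (evalLin K q t f (α₀ · u + (α₀ · b + a · α₁ · B) · evalLin K q t g u)
            - α₁ · u - (a · α₀ + a · α₁ · A + b · α₁) · evalLin K q t g u ≈ 0#)) k →
       HasDim₂ K q (InWeightSpace K q t f ξ g η α) k)
corollary3p7 q t q-primePower _ K isField size ξ η ξ∉ η∉ f g f∈ g∈ A B a b A∈ B∈ a∈ b∈ ξ² η≈aξ+b
             α _ α₀ α₁ α₀∈ α₁∈ αω≈1 k =
  preimage-HasDim , image-HasDim
  where
  additive : Frobenius.AdditivePower K q
  additive = FiniteField.primePower-additive K isField size {n = 2 * t} q-primePower refl
  open WeightSpace K isField q t additive
  open Embedding ξ∉ η∉ f∈ g∈ A∈ B∈ a∈ b∈ ξ² η≈aξ+b α₀∈ α₁∈ αω≈1
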